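{- Consider two reasonable partial packings of the same set of items into the same sequence of bins. Suppose that before bin $b$, each packing has at least one item of size $S$ and at least one item of size $L$ available. Then immediately after bin $b$ has been packed, the number of items of size $S$ available plus twice the number of items of size $L$ available is the same for both packings.
   Context: Restricted Grid Scheduling setting: $S>1$ is an integer, $L=2S-1$, $M=4S-3$; items have size $S$ or $L$; bins have integer sizes in $[S,M]$ and arrive in a sequence. An item is available (for a partial packing, at a given point in the sequence) if it has not been assigned to any bin up to that point. A partial packing is reasonable if every bin $b$ it packs contains: one item of size $S$ if $\mathrm{size}(b)\in[S,L-1]$; one item of size $L$ if $\mathrm{size}(b)=L$; two items of size $S$ or one item of size $L$ if $\mathrm{size}(b)\in[L+1,L+S-1]$; one item of size $S$ and one of size $L$ if $\mathrm{size}(b)=L+S$; three items of size $S$ or one item of size $S$ and one of size $L$ if $\mathrm{size}(b)\in[L+S+1,2L-1]$. -}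

module Defs where

open import Data.Nat using (ℕ; zero; suc; _+_; _*_; _∸_; _≤_; _<_)
open import Data.Fin using (Fin; toℕ)
open import Data.Bool using (Bool; true; false; if_then_else_)
open import Data.Maybe using (Maybe; just; nothing)
open import Data.Product using (_×_)
open import Data.Sum using (_⊎_)
open import Relation.Binary.PropositionalEquality using (_≡_)
open import Relation.Nullary.Decidable using (⌊_⌋)
open import Data.Nat using (_≤?_; _<?_)
open import Data.Fin using (_≟_)

L : ℕ → ℕ
L S = 2 * S ∸ 1

M : ℕ → ℕ
M S = 4 * S ∸ 3

-- The two possible item sizes: small = size S, large = size L.
data ItemSize : Set where
  small large : ItemSize

isSmall : ItemSize → Bool
isSmall small = true
isSmall large = false

isLarge : ItemSize → Bool
isLarge small = false
isLarge large = true

count : ∀ {n} → (Fin n → Bool) → ℕ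
count {zero}  p = 0
count {suc n} p = (if p Fin.zero then 1 else 0) + count (λ i → p (Fin.suc i))

-- A partial packing of items Fin n into the bin sequence Fin k:
-- it packs the initial segment of the first `packed` bins; every item is
-- either unassigned (nothing) or assigned to one of these packed bins.
record PartialPacking (n k : ℕ) : Set where
  field
    packed  : ℕ
    packed≤ : packed ≤ k
    assign  : Fin n → Maybe (Fin k)
    assign< : ∀ i j → assign i ≡ just j → toℕ j < packed
open PartialPacking public

inBin : ∀ {k} → Maybe (Fin k) → Fin k → Bool
inBin nothing  j = false
inBin (just j′) j = ⌊ j′ ≟ j ⌋

contentS contentL : ∀ {n k} → (Fin n → ItemSize) → PartialPacking n k → Fin k → ℕ
contentS size P j = count (λ i → if isSmall (size i) then inBin (assign P i) j else false)
contentL size P j = count (λ i → if isLarge (size i) then inBin (assign P i) j else false)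

ReasonableContent : (S s nS nL : ℕ) → Set
ReasonableContent S s nS nL =
    (s < L S × nS ≡ 1 × nL ≡ 0)
  ⊎ (s ≡ L S × nS ≡ 0 × nL ≡ 1)
  ⊎ (L S + 1 ≤ s × s ≤ L S + S ∸ 1 × ((nS ≡ 2 × nL ≡ 0) ⊎ (nS ≡ 0 × nL ≡ 1)))
  ⊎ (s ≡ L S + S × nS ≡ 1 × nL ≡ 1)
  ⊎ (L S + S + 1 ≤ s × s ≤ 2 * L S ∸ 1 × ((nS ≡ 3 × nL ≡ 0) ⊎ (nS ≡ 1 × nL ≡ 1)))

Reasonable : ∀ {n k} → (S : ℕ) → (Fin n → ItemSize) → (Fin k → ℕ) → PartialPacking n k → Set
Reasonable S size bin P =
  ∀ j → toℕ j < packed P → ReasonableContent S (bin j) (contentS size P j) (contentL size P j)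

availBefore : ∀ {k} → Maybe (Fin k) → Fin k → Bool
availBefore nothing  b = true
availBefore (just j) b = ⌊ toℕ b ≤? toℕ j ⌋

availAfter : ∀ {k} → Maybe (Fin k) → Fin k → Bool
availAfter nothing  b = true
availAfter (just j) b = ⌊ toℕ b <? toℕ j ⌋

availS-before availL-before availS-after availL-after :
  ∀ {n k} → (Fin n → ItemSize) → PartialPacking n k → Fin k → ℕ
availS-before size P b = count (λ i → if isSmall (size i) then availBefore (assign P i) b else false)
availL-before size P b = count (λ i → if isLarge (size i) then availBefore (assign P i) b else false)
availS-after  size P b = count (λ i → if isSmall (size i) then availAfter (assign P i) b else false)
availL-after  size P b = count (λ i → if isLarge (size i) then availAfter (assign P i) b else false)

-- Weigh an item 1 if it has size S and 2 if it has size L. In a reasonable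
-- packing the weight a bin removes from the available items is determined by
-- the size of the bin alone: 1 below L, 2 on [L, L+S), 3 from L+S on. Both
-- packings start from the same items, hence the same available weight, so by
-- induction over the bins the available weights agree after every bin that
-- both of them pack.
module Submission where

open import Defs
open import Data.Nat using (ℕ; zero; suc; _+_; _*_; _≤_; _<_; _≤?_; _<?_; z<s; s≤s)
open import Data.Nat.Properties
open import Algebra.Properties.Semiring.Sum +-*-semiring using (sum; sum-cong-≗; ∑-distrib-+; *-distribˡ-sum)
open import Data.Fin using (Fin; toℕ; fromℕ<) renaming (_≟_ to _≟ᶠ_)
open import Data.Fin.Properties using (toℕ<n; toℕ-fromℕ<; toℕ-injective)
open import Data.Bool using (Bool; true; false; if_then_else_)
open import Data.Maybe using (Maybe; just; nothing)
open import Data.Product using (_×_; _,_)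
open import Data.Sum using (_⊎_; inj₁; inj₂)
open import Relation.Nullary using (yes; no; contradiction)
open import Relation.Nullary.Decidable using (⌊_⌋)
open import Relation.Binary.PropositionalEquality

bit : Bool → ℕ
bit b = if b then 1 else 0

count≡∑bit : ∀ {n} (p : Fin n → Bool) → count p ≡ sum (λ i → bit (p i))
count≡∑bit {zero}  p = refl
count≡∑bit {suc n} p = cong (bit (p Fin.zero) +_) (count≡∑bit (λ i → p (Fin.suc i)))

weight : ItemSize → ℕ
weight small = 1
weight large = 2

weightOf : ∀ {n} → (Fin n → ItemSize) → (Fin n → Bool) → ℕ
weightOf size p = sum (λ i → weight (size i) * bit (p i))

weightOf-cong : ∀ {n} (size : Fin n → ItemSize) {p q : Fin n → Bool} →
                (∀ i → p i ≡ q i) → weightOf size p ≡ weightOf size q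
weightOf-cong size p≗q = sum-cong-≗ (λ i → cong (λ b → weight (size i) * bit b) (p≗q i))

weightOf-split : ∀ {n} (size : Fin n → ItemSize) {p q r : Fin n → Bool} →
                 (∀ i → bit (p i) ≡ bit (q i) + bit (r i)) →
                 weightOf size p ≡ weightOf size q + weightOf size r
weightOf-split size {p} {q} {r} split = begin
  sum (λ i → weight (size i) * bit (p i))
    ≡⟨ sum-cong-≗ (λ i → trans (cong (weight (size i) *_) (split i))
                               (*-distribˡ-+ (weight (size i)) (bit (q i)) (bit (r i)))) ⟩
  sum (λ i → weight (size i) * bit (q i) + weight (size i) * bit (r i))
    ≡⟨ ∑-distrib-+ (λ i → weight (size i) * bit (q i)) (λ i → weight (size i) * bit (r i)) ⟩
  weightOf size q + weightOf size r ∎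
  where open ≡-Reasoning

weightOf-counts : ∀ {n} (size : Fin n → ItemSize) (p : Fin n → Bool) →
                  count (λ i → if isSmall (size i) then p i else false)
                    + 2 * count (λ i → if isLarge (size i) then p i else false)
                  ≡ weightOf size p
weightOf-counts size p = begin
  count pS + 2 * count pL
    ≡⟨ cong₂ (λ x y → x + 2 * y) (count≡∑bit pS) (count≡∑bit pL) ⟩
  sum (λ i → bit (pS i)) + 2 * sum (λ i → bit (pL i))
    ≡⟨ cong (sum (λ i → bit (pS i)) +_) (*-distribˡ-sum 2 (λ i → bit (pL i))) ⟩
  sum (λ i → bit (pS i)) + sum (λ i → 2 * bit (pL i))
    ≡⟨ ∑-distrib-+ (λ i → bit (pS i)) (λ i → 2 * bit (pL i)) ⟨
  sum (λ i → bit (pS i) + 2 * bit (pL i))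
    ≡⟨ sum-cong-≗ (λ i → itemWeight (size i) (p i)) ⟩
  weightOf size p ∎
  where
  open ≡-Reasoning
  pS pL : Fin _ → Bool
  pS i = if isSmall (size i) then p i else false
  pL i = if isLarge (size i) then p i else false
  itemWeight : ∀ z b → bit (if isSmall z then b else false) + 2 * bit (if isLarge z then b else false)
                       ≡ weight z * bit b
  itemWeight small true  = refl
  itemWeight small false = refl
  itemWeight large true  = refl
  itemWeight large false = refl

-- The weight a reasonable packing must put into a bin of size s.
demand : ℕ → ℕ → ℕ
demand S s with s <? L S | s <? L S + S
... | yes _ | _     = 1
... | no _  | yes _ = 2
... | no _  | no _  = 3

demand≡1 : ∀ {S s} → s < L S → demand S s ≡ 1
demand≡1 {S} {s} s<L with s <? L S
... | yes _  = refl
... | no s≮L = contradiction s<L s≮L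

demand≡2 : ∀ {S s} → L S ≤ s → s < L S + S → demand S s ≡ 2
demand≡2 {S} {s} L≤s s<L+S with s <? L S | s <? L S + S
... | yes s<L | _        = contradiction L≤s (<⇒≱ s<L)
... | no _    | yes _    = refl
... | no _    | no s≮L+S = contradiction s<L+S s≮L+S

demand≡3 : ∀ {S s} → L S + S ≤ s → demand S s ≡ 3
demand≡3 {S} {s} L+S≤s with s <? L S | s <? L S + S
... | yes s<L | _        = contradiction (≤-trans (m≤m+n (L S) S) L+S≤s) (<⇒≱ s<L)
... | no _    | yes s<L+S = contradiction L+S≤s (<⇒≱ s<L+S)
... | no _    | no _      = refl

reasonableContent⇒weight≡demand : ∀ {S s nS nL} → 0 < S → ReasonableContent S s nS nL →
                                  nS + 2 * nL ≡ demand S s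
reasonableContent⇒weight≡demand _ (inj₁ (s<L , refl , refl)) = sym (demand≡1 s<L)
reasonableContent⇒weight≡demand {S} S>0 (inj₂ (inj₁ (refl , refl , refl))) =
  sym (demand≡2 ≤-refl (m<m+n (L S) S>0))
reasonableContent⇒weight≡demand {S} {s} S>0 (inj₂ (inj₂ (inj₁ (L+1≤s , s≤L+S-1 , content)))) =
  trans (weight-of content) (sym (demand≡2 (≤-trans (m≤m+n (L S) 1) L+1≤s) s<L+S))
  where
  s<L+S : s < L S + S
  s<L+S = ≤-<-trans s≤L+S-1 (∸-monoʳ-< z<s (≤-trans S>0 (m≤n+m S (L S))))
  weight-of : ∀ {nS nL} → (nS ≡ 2 × nL ≡ 0) ⊎ (nS ≡ 0 × nL ≡ 1) → nS + 2 * nL ≡ 2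
  weight-of (inj₁ (refl , refl)) = refl
  weight-of (inj₂ (refl , refl)) = refl
reasonableContent⇒weight≡demand _ (inj₂ (inj₂ (inj₂ (inj₁ (refl , refl , refl))))) = sym (demand≡3 ≤-refl)
reasonableContent⇒weight≡demand {S} _ (inj₂ (inj₂ (inj₂ (inj₂ (L+S+1≤s , _ , content))))) =
  trans (weight-of content) (sym (demand≡3 (≤-trans (m≤m+n (L S + S) 1) L+S+1≤s)))
  where
  weight-of : ∀ {nS nL} → (nS ≡ 3 × nL ≡ 0) ⊎ (nS ≡ 1 × nL ≡ 1) → nS + 2 * nL ≡ 3
  weight-of (inj₁ (refl , refl)) = refl
  weight-of (inj₂ (refl , refl)) = refl

-- Availability when bin t is reached; t ranges over ℕ rather than Fin k so that
-- the moment right after bin b is simply suc (toℕ b).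
availableAt : ∀ {k} → Maybe (Fin k) → ℕ → Bool
availableAt nothing  t = true
availableAt (just j) t = ⌊ t ≤? toℕ j ⌋

availableAt-zero : ∀ {k} (a : Maybe (Fin k)) → availableAt a 0 ≡ true
availableAt-zero nothing  = refl
availableAt-zero (just j) = refl

availAfter≡availableAt : ∀ {k} (a : Maybe (Fin k)) (b : Fin k) → availAfter a b ≡ availableAt a (suc (toℕ b))
availAfter≡availableAt nothing  b = refl
availAfter≡availableAt (just j) b = refl

≤?-≢-suc : ∀ {t y} → t ≢ y → ⌊ t ≤? y ⌋ ≡ ⌊ suc t ≤? y ⌋
≤?-≢-suc {t} {y} t≢y with t ≤? y | suc t ≤? y
... | yes _   | yes _    = refl
... | no _    | no _     = refl
... | no t≰y  | yes t<y  = contradiction (<⇒≤ t<y) t≰y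
... | yes t≤y | no t≮y   = contradiction (≤∧≢⇒< t≤y t≢y) t≮y

≤?-refl-suc : ∀ t → bit ⌊ t ≤? t ⌋ ≡ bit ⌊ suc t ≤? t ⌋ + 1
≤?-refl-suc t with t ≤? t | suc t ≤? t
... | yes _   | no _    = refl
... | no t≰t  | _       = contradiction ≤-refl t≰t
... | yes _   | yes t<t = contradiction t<t (n≮n t)

availableAt-step : ∀ {k} (a : Maybe (Fin k)) (j : Fin k) →
                   bit (availableAt a (toℕ j)) ≡ bit (availableAt a (suc (toℕ j))) + bit (inBin a j)
availableAt-step nothing  j = refl
availableAt-step (just y) j with y ≟ᶠ j
... | yes refl = ≤?-refl-suc (toℕ y)
... | no y≢j   =
  trans (cong bit (≤?-≢-suc (λ j≡y → y≢j (toℕ-injective (sym j≡y))))) (sym (+-identityʳ _))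

availableWeight : ∀ {n k} → (Fin n → ItemSize) → PartialPacking n k → ℕ → ℕ
availableWeight size P t = weightOf size (λ i → availableAt (assign P i) t)

binWeight : ∀ {n k} → (Fin n → ItemSize) → PartialPacking n k → Fin k → ℕ
binWeight size P j = weightOf size (λ i → inBin (assign P i) j)

availableWeight-zero : ∀ {n k} (size : Fin n → ItemSize) (P : PartialPacking n k) →
                       availableWeight size P 0 ≡ weightOf size (λ _ → true)
availableWeight-zero size P = weightOf-cong size (λ i → availableAt-zero (assign P i))

availableWeight-step : ∀ {n k} (size : Fin n → ItemSize) (P : PartialPacking n k) (j : Fin k) {t} →
                       toℕ j ≡ t → availableWeight size P t ≡ availableWeight size P (suc t) + binWeight size P j
availableWeight-step size P j refl = weightOf-split size (λ i → availableAt-step (assign P i) j)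

availableWeight-agree : ∀ {n k} (size : Fin n → ItemSize) (P Q : PartialPacking n k) t → t ≤ k →
                        (∀ j → toℕ j < t → binWeight size P j ≡ binWeight size Q j) →
                        availableWeight size P t ≡ availableWeight size Q t
availableWeight-agree size P Q zero _ _ =
  trans (availableWeight-zero size P) (sym (availableWeight-zero size Q))
availableWeight-agree size P Q (suc t) t<k agree = +-cancelʳ-≡ (binWeight size P j) _ _ (begin
  availableWeight size P (suc t) + binWeight size P j ≡⟨ availableWeight-step size P j j≡t ⟨
  availableWeight size P t                            ≡⟨ availableWeight-agree size P Q t (<⇒≤ t<k) agree-before ⟩
  availableWeight size Q t                            ≡⟨ availableWeight-step size Q j j≡t ⟩
  availableWeight size Q (suc t) + binWeight size Q j ≡⟨ cong (availableWeight size Q (suc t) +_) agree-at ⟨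
  availableWeight size Q (suc t) + binWeight size P j ∎)
  where
  open ≡-Reasoning
  j : Fin _
  j = fromℕ< t<k
  j≡t : toℕ j ≡ t
  j≡t = toℕ-fromℕ< t<k
  agree-before : ∀ i → toℕ i < t → binWeight size P i ≡ binWeight size Q i
  agree-before i i<t = agree i (m<n⇒m<1+n i<t)
  agree-at : binWeight size P j ≡ binWeight size Q j
  agree-at = agree j (s≤s (≤-reflexive j≡t))

availableAfter-weight : ∀ {n k} (size : Fin n → ItemSize) (P : PartialPacking n k) (b : Fin k) →
                        availS-after size P b + 2 * availL-after size P b ≡ availableWeight size P (suc (toℕ b))
availableAfter-weight size P b =
  trans (weightOf-counts size (λ i → availAfter (assign P i) b))
        (weightOf-cong size (λ i → availAfter≡availableAt (assign P i) b))

reasonable⇒binWeight≡demand : ∀ {S n k bin} {size : Fin n → ItemSize} {P : PartialPacking n k} → 0 < S →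
                              Reasonable S size bin P → (j : Fin k) → toℕ j < packed P →
                              binWeight size P j ≡ demand S (bin j)
reasonable⇒binWeight≡demand {size = size} {P} S>0 reasonable j j<packed =
  trans (sym (weightOf-counts size (λ i → inBin (assign P i) j)))
        (reasonableContent⇒weight≡demand S>0 (reasonable j j<packed))

lemma4 : (S : ℕ) → 1 < S → (n k : ℕ) → (size : Fin n → ItemSize) → (bin : Fin k → ℕ)
         → (∀ j → S ≤ bin j × bin j ≤ M S)
         → (P Q : PartialPacking n k)
         → Reasonable S size bin P → Reasonable S size bin Q
         → (b : Fin k) → toℕ b < packed P → toℕ b < packed Q
         → 1 ≤ availS-before size P b → 1 ≤ availL-before size P b
         → 1 ≤ availS-before size Q b → 1 ≤ availL-before size Q b
         → availS-after size P b + 2 * availL-after size P b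
           ≡ availS-after size Q b + 2 * availL-after size Q b
lemma4 S 1<S n k size bin _ P Q reasonableP reasonableQ b b<P b<Q _ _ _ _ = begin
  availS-after size P b + 2 * availL-after size P b ≡⟨ availableAfter-weight size P b ⟩
  availableWeight size P (suc (toℕ b))              ≡⟨ availableWeight-agree size P Q (suc (toℕ b)) (toℕ<n b) sameBinWeight ⟩
  availableWeight size Q (suc (toℕ b))              ≡⟨ availableAfter-weight size Q b ⟨
  availS-after size Q b + 2 * availL-after size Q b ∎
  where
  open ≡-Reasoning
  S>0 : 0 < S
  S>0 = <⇒≤ 1<S
  sameBinWeight : ∀ j → toℕ j < suc (toℕ b) → binWeight size P j ≡ binWeight size Q j
  sameBinWeight j (s≤s j≤b) =
    trans (reasonable⇒binWeight≡demand {P = P} S>0 reasonableP j (≤-<-trans j≤b b<P))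
          (sym (reasonable⇒binWeight≡demand {P = Q} S>0 reasonableQ j (≤-<-trans j≤b b<Q)))
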